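{- For an integer $k\ge2$, let $\mathcal{P}_k$ be the class of graphs having no hole whose length is a multiple of $k$. Then $\mathcal{P}_k$ is neither expressible by forbidden orientations nor expressible by forbidden acyclic orientations. In particular, the class of even-hole-free graphs is neither expressible by forbidden orientations nor by forbidden acyclic orientations.
   Context: Graphs are finite and simple. A hole in a graph is an induced cycle of length at least four. An oriented graph is a digraph without loops, parallel arcs or pairs of opposite arcs; an orientation of a graph assigns a direction to each edge; it is acyclic if it has no directed cycle. For a set $F$ of oriented graphs, an oriented graph is $F$-free if no member of $F$ is isomorphic to an induced subdigraph of it. A graph class $\mathcal{P}$ is expressible by forbidden orientations if there is a finite set $F$ of oriented graphs such that a graph belongs to $\mathcal{P}$ iff it admits an $F$-free orientation; it is expressible by forbidden acyclic orientations if there is a finite $F$ such that a graph belongs to $\mathcal{P}$ iff it admits an acyclic $F$-free orientation. -}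

module Defs where

open import Data.Nat using (ℕ; zero; suc; _≤_)
open import Data.Nat.Divisibility using (_∣_)
open import Data.Fin using (Fin; toℕ)
open import Data.Bool using (Bool; true; false; _∨_)
open import Data.List using (List)
open import Data.List.Membership.Propositional using (_∈_)
open import Data.Product using (Σ; _×_; ∃)
open import Data.Sum using (_⊎_)
open import Relation.Nullary using (¬_)
open import Relation.Binary.PropositionalEquality using (_≡_)
open import Function.Definitions using (Injective)
open import Function.Bundles using (_⇔_)

record Graph (n : ℕ) : Set where
  field
    adj    : Fin n → Fin n → Bool
    sym    : ∀ u v → adj u v ≡ adj v u
    irrefl : ∀ u → adj u u ≡ false
open Graph public

record OGraph (n : ℕ) : Set where
  field
    arc    : Fin n → Fin n → Bool
    irrefl : ∀ u → arc u u ≡ false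
    asym   : ∀ u v → arc u v ≡ true → arc v u ≡ false
open OGraph public

CycAdj : (L : ℕ) → Fin L → Fin L → Set
CycAdj L i j =
  (toℕ j ≡ suc (toℕ i)) ⊎ (toℕ i ≡ suc (toℕ j)) ⊎
  ((toℕ i ≡ 0 × suc (toℕ j) ≡ L) ⊎ (toℕ j ≡ 0 × suc (toℕ i) ≡ L))

CycSucc : (L : ℕ) → Fin L → Fin L → Set
CycSucc L i j = (toℕ j ≡ suc (toℕ i)) ⊎ (suc (toℕ i) ≡ L × toℕ j ≡ 0)

IsHole : ∀ {n} → Graph n → (L : ℕ) → (Fin L → Fin n) → Set
IsHole G L f =
  4 ≤ L × Injective _≡_ _≡_ f ×
  (∀ i j → adj G (f i) (f j) ≡ true ⇔ CycAdj L i j)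

HasHoleOfLength : ∀ {n} → Graph n → ℕ → Set
HasHoleOfLength G L = Σ (Fin L → _) (IsHole G L)

Pk : ℕ → (n : ℕ) → Graph n → Set
Pk k n G = ∀ L → k ∣ L → ¬ HasHoleOfLength G L

IsOrientation : ∀ {n} → Graph n → OGraph n → Set
IsOrientation G D = ∀ u v → adj G u v ≡ (arc D u v ∨ arc D v u)

HasDirectedCycle : ∀ {n} → OGraph n → Set
HasDirectedCycle {n} D =
  Σ ℕ λ L → Σ (Fin L → Fin n) λ f →
    2 ≤ L × Injective _≡_ _≡_ f × (∀ i j → CycSucc L i j → arc D (f i) (f j) ≡ true)

Acyclic : ∀ {n} → OGraph n → Set
Acyclic D = ¬ HasDirectedCycle D

EmbedsInduced : ∀ {m n} → OGraph m → OGraph n → Set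
EmbedsInduced {m} {n} H D =
  Σ (Fin m → Fin n) λ φ → Injective _≡_ _≡_ φ × (∀ i j → arc H i j ≡ arc D (φ i) (φ j))

AnyOGraph : Set
AnyOGraph = Σ ℕ OGraph

Free : ∀ {n} → List AnyOGraph → OGraph n → Set
Free F D = ∀ {H} → H ∈ F → ¬ EmbedsInduced (Data.Product.proj₂ H) D

GraphClass : Set₁
GraphClass = (n : ℕ) → Graph n → Set

ExpressibleByForbiddenOrientations : GraphClass → Set
ExpressibleByForbiddenOrientations P =
  Σ (List AnyOGraph) λ F → ∀ n (G : Graph n) →
    P n G ⇔ (Σ (OGraph n) λ D → IsOrientation G D × Free F D)

ExpressibleByForbiddenAcyclicOrientations : GraphClass → Set
ExpressibleByForbiddenAcyclicOrientations P =
  Σ (List AnyOGraph) λ F → ∀ n (G : Graph n) →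
    P n G ⇔ (Σ (OGraph n) λ D → IsOrientation G D × Acyclic D × Free F D)

{-# OPTIONS --safe #-}
-- Let N bound the orders of the forbidden oriented graphs, pick q > N with k ∤ q, and put M = k q.
-- A disjoint union of many q-cycles lies in P_k, so it has an admissible orientation; by pigeonhole
-- M of its copies are oriented identically. Orient the M-cycle C_M, which does not lie in P_k, by
-- copying that orientation along positions modulo q (q ∣ M makes this consistent around C_M).
-- An oriented graph on at most N vertices inside C_M misses a vertex, so it lives in a path, split
-- into runs of fewer than q consecutive vertices; sending each run to a copy of its own embeds it
-- induced into the orientation of the copies. Hence C_M inherits freeness, and also acyclicity,
-- because an acyclic oriented q-cycle has a sink and an oriented cycle with a sink is acyclic.
module Submission where

open import Defs hiding (sym)
open import Data.Bool as Bool using (Bool; true; false; _∧_; _∨_)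
open import Data.Bool.Properties using (¬-not; ∧-zeroʳ; ∧-conicalˡ; ∧-conicalʳ; ∨-conicalˡ)
open import Data.Fin as Fin using (Fin; toℕ; fromℕ<)
open import Data.Fin.Properties
  using ( toℕ-fromℕ<; toℕ-injective; toℕ<n; fromℕ<-cong; toℕ-inject₁; toℕ-inject≤; inject≤-injective
        ; any?; all?; ¬∀⟶∃¬; injective⇒≤; remQuot-combine; combine-remQuot; combine-injectiveˡ
        ; combine-injectiveʳ; opposite-prop; opposite-involutive )
open import Data.List as List using (List; allFin; filter; length; lookup)
open import Data.List.Extrema.Nat using (argmax; f[xs]≤f[argmax]; max; xs≤max)
open import Data.List.Membership.Propositional using (_∈_)
open import Data.List.Membership.Propositional.Properties using (∈-allFin; ∈-filter⁻; ∈-lookup; ∈-map⁺)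
open import Data.List.Properties using (length-tabulate)
open import Data.List.Relation.Binary.Subset.Propositional using (_⊆_)
import Data.List.Relation.Unary.All as All
open import Data.List.Relation.Unary.AllPairs using (_∷_)
open import Data.List.Relation.Unary.Unique.Propositional using (Unique)
import Data.List.Relation.Unary.Unique.Propositional.Properties as Unique
open import Data.Nat
  using (ℕ; zero; suc; pred; _+_; _*_; _∸_; _^_; _≤_; _<_; z≤n; s≤s; _≟_; _≤?_; NonZero; >-nonZero; >-nonZero⁻¹)
open import Data.Nat.DivMod
open import Data.Nat.Divisibility using (_∣_; ∣⇒≤; ∣1⇒≡1; ∣m+n∣m⇒∣n; m∣m*n; n∣m*n)
open import Data.Nat.Properties
open import Data.Product using (Σ; ∃; _×_; _,_; proj₁; proj₂)
open import Data.Sum using (_⊎_; inj₁; inj₂; swap; [_,_]′)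
open import Data.Vec.Functional as Vector using (Vector)
open import Function using (_∘_)
open import Function.Bundles using (_⇔_; mk⇔; Equivalence)
open import Function.Construct.Composition using (_⇔-∘_)
open import Function.Definitions using (Injective)
open import Relation.Binary.PropositionalEquality
  using (_≡_; _≢_; refl; sym; trans; cong; cong₂; subst; subst₂; module ≡-Reasoning)
open import Relation.Nullary using (¬_; contradiction; Dec; does; yes; no; ¬?)
open import Relation.Nullary.Decidable using (_×-dec_; _⊎-dec_; dec-true; dec-false; does-⇔; decidable-stable)
open import Relation.Unary using (Decidable)

open ≡-Reasoning

module _ {n : ℕ} .{{_ : NonZero n}} where

  +-congˡ-% : ∀ w {x y} → x % n ≡ y % n → (w + x) % n ≡ (w + y) % n
  +-congˡ-% w {x} {y} eq = begin
    (w + x) % n           ≡⟨ %-distribˡ-+ w x n ⟩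
    (w % n + x % n) % n   ≡⟨ cong (λ z → (w % n + z) % n) eq ⟩
    (w % n + y % n) % n   ≡⟨ %-distribˡ-+ w y n ⟨
    (w + y) % n           ∎

  +-congʳ-% : ∀ w {x y} → x % n ≡ y % n → (x + w) % n ≡ (y + w) % n
  +-congʳ-% w {x} {y} eq =
    trans (cong (_% n) (+-comm x w)) (trans (+-congˡ-% w eq) (cong (_% n) (+-comm w y)))

  [1+m%n]%n≡[1+m]%n : ∀ m → suc (m % n) % n ≡ suc m % n
  [1+m%n]%n≡[1+m]%n m = +-congˡ-% 1 (m%n%n≡m%n m n)

  +-cancelˡ-% : ∀ u {a b} → a < n → b < n → (u + a) % n ≡ (u + b) % n → a ≡ b
  +-cancelˡ-% u {a} {b} a<n b<n eq = begin
    a                   ≡⟨ m<n⇒m%n≡m a<n ⟨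
    a % n               ≡⟨ undo a ⟨
    (w + (u + a)) % n   ≡⟨ +-congˡ-% w eq ⟩
    (w + (u + b)) % n   ≡⟨ undo b ⟩
    b % n               ≡⟨ m<n⇒m%n≡m b<n ⟩
    b                   ∎
    where
    w = n ∸ u % n
    undo : ∀ x → (w + (u + x)) % n ≡ x % n
    undo x = begin
      (w + (u + x)) % n       ≡⟨ +-congˡ-% w (+-congʳ-% x (m%n%n≡m%n u n)) ⟨
      (w + (u % n + x)) % n   ≡⟨ cong (_% n) (+-assoc w (u % n) x) ⟨
      (w + u % n + x) % n     ≡⟨ cong (λ z → (z + x) % n) (m∸n+n≡m (m%n≤n u n)) ⟩
      (n + x) % n             ≡⟨ cong (_% n) (+-comm n x) ⟩
      (x + n) % n             ≡⟨ [m+n]%n≡m%n x n ⟩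
      x % n                   ∎

next : ∀ {n} → Fin n → Fin n
next {suc n} i = suc (toℕ i) mod suc n

prev : ∀ {n} → Fin n → Fin n
prev {suc n} i = (toℕ i + n) mod suc n

toℕ-next : ∀ {n} .{{_ : NonZero n}} (i : Fin n) → toℕ (next i) ≡ suc (toℕ i) % n
toℕ-next {suc n} i = toℕ-fromℕ< _

toℕ-prev : ∀ {n} .{{_ : NonZero n}} (i : Fin n) → toℕ (prev i) ≡ (toℕ i + pred n) % n
toℕ-prev {suc n} i = toℕ-fromℕ< _

CycSucc-next : ∀ {n} (i : Fin n) → CycSucc n i (next i)
CycSucc-next {suc n} i with m≤n⇒m<n∨m≡n (toℕ<n i)
... | inj₁ 1+i<n = inj₁ (trans (toℕ-next i) (m<n⇒m%n≡m 1+i<n))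
... | inj₂ 1+i≡n = inj₂ (1+i≡n , trans (toℕ-next i) (trans (cong (_% suc n) 1+i≡n) (n%n≡0 (suc n))))

CycSucc⇒next : ∀ {n} {i j : Fin n} → CycSucc n i j → next i ≡ j
CycSucc⇒next {suc n} {i} {j} (inj₁ j≡1+i) =
  toℕ-injective (trans (toℕ-next i) (trans (cong (_% suc n) (sym j≡1+i)) (m<n⇒m%n≡m (toℕ<n j))))
CycSucc⇒next {suc n} {i} {j} (inj₂ (1+i≡n , j≡0)) =
  toℕ-injective (trans (toℕ-next i) (trans (cong (_% suc n) 1+i≡n) (trans (n%n≡0 (suc n)) (sym j≡0))))

module _ {n : ℕ} .{{_ : NonZero n}} where

  [toℕ+0]%n≡toℕ : ∀ (i : Fin n) → (toℕ i + 0) % n ≡ toℕ i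
  [toℕ+0]%n≡toℕ i = trans (cong (_% n) (+-identityʳ (toℕ i))) (m<n⇒m%n≡m (toℕ<n i))

  toℕ-next-% : ∀ {x : Fin n} {w} → toℕ x ≡ w % n → toℕ (next x) ≡ suc w % n
  toℕ-next-% {x} {w} eq = trans (toℕ-next x) (trans (cong (λ z → suc z % n) eq) ([1+m%n]%n≡[1+m]%n w))

  next-prev : ∀ i → next (prev i) ≡ i
  next-prev i = toℕ-injective (begin
    toℕ (next (prev i))          ≡⟨ toℕ-next-% (toℕ-prev i) ⟩
    suc (toℕ i + pred n) % n     ≡⟨ cong (_% n) (+-suc (toℕ i) (pred n)) ⟨
    (toℕ i + suc (pred n)) % n   ≡⟨ cong (λ z → (toℕ i + z) % n) (suc-pred n) ⟩
    (toℕ i + n) % n              ≡⟨ [m+n]%n≡m%n (toℕ i) n ⟩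
    toℕ i % n                    ≡⟨ m<n⇒m%n≡m (toℕ<n i) ⟩
    toℕ i                        ∎)

  next-injective : Injective _≡_ _≡_ (next {n})
  next-injective {i} {j} eq = toℕ-injective (+-cancelˡ-% 1 (toℕ<n i) (toℕ<n j)
    (trans (sym (toℕ-next i)) (trans (cong toℕ eq) (toℕ-next j))))

  next≢id : 2 ≤ n → ∀ i → next i ≢ i
  next≢id 2≤n i eq = contradiction (+-cancelˡ-% (toℕ i) 2≤n (>-nonZero⁻¹ n) (begin
    (toℕ i + 1) % n   ≡⟨ cong (_% n) (+-comm (toℕ i) 1) ⟩
    suc (toℕ i) % n   ≡⟨ toℕ-next i ⟨
    toℕ (next i)      ≡⟨ cong toℕ eq ⟩
    toℕ i             ≡⟨ [toℕ+0]%n≡toℕ i ⟨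
    (toℕ i + 0) % n   ∎)) λ ()

  next²≡id⇒≤2 : ∀ i → next (next i) ≡ i → n ≤ 2
  next²≡id⇒≤2 i eq with n ≤? 2
  ... | yes n≤2 = n≤2
  ... | no n≰2 = contradiction (+-cancelˡ-% (toℕ i) (≰⇒> n≰2) (>-nonZero⁻¹ n) (begin
    (toℕ i + 2) % n         ≡⟨ cong (_% n) (+-comm (toℕ i) 2) ⟩
    suc (suc (toℕ i)) % n   ≡⟨ toℕ-next-% (toℕ-next i) ⟨
    toℕ (next (next i))     ≡⟨ cong toℕ eq ⟩
    toℕ i                   ≡⟨ [toℕ+0]%n≡toℕ i ⟨
    (toℕ i + 0) % n         ∎)) λ ()

  next-opposite-next : ∀ i → next (Fin.opposite (next i)) ≡ Fin.opposite i
  next-opposite-next i = toℕ-injective (begin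
    toℕ (next (Fin.opposite (next i)))      ≡⟨ toℕ-next (Fin.opposite (next i)) ⟩
    suc (toℕ (Fin.opposite (next i))) % n   ≡⟨ cong (λ z → suc z % n) (opposite-prop (next i)) ⟩
    suc (n ∸ suc (toℕ (next i))) % n        ≡⟨ by-cases (CycSucc-next i) ⟩
    (n ∸ suc (toℕ i)) % n                   ≡⟨ cong (_% n) (opposite-prop i) ⟨
    toℕ (Fin.opposite i) % n                ≡⟨ m<n⇒m%n≡m (toℕ<n (Fin.opposite i)) ⟩
    toℕ (Fin.opposite i)                    ∎)
    where
    by-cases : CycSucc n i (next i) → suc (n ∸ suc (toℕ (next i))) % n ≡ (n ∸ suc (toℕ i)) % n
    by-cases (inj₁ next≡1+i) = trans (cong (λ z → suc (n ∸ suc z) % n) next≡1+i)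
      (cong (_% n) (sym (+-∸-assoc 1 (subst (_< n) next≡1+i (toℕ<n (next i))))))
    by-cases (inj₂ (1+i≡n , next≡0)) = begin
      suc (n ∸ suc (toℕ (next i))) % n   ≡⟨ cong (λ z → suc (n ∸ suc z) % n) next≡0 ⟩
      suc (n ∸ 1) % n                    ≡⟨ cong (_% n) (m+[n∸m]≡n (>-nonZero⁻¹ n)) ⟩
      n % n                              ≡⟨ n%n≡0 n ⟩
      0                                  ≡⟨ m<n⇒m%n≡m (>-nonZero⁻¹ n) ⟨
      0 % n                              ≡⟨ cong (_% n) (trans (cong (n ∸_) 1+i≡n) (n∸n≡0 n)) ⟨
      (n ∸ suc (toℕ i)) % n              ∎

  -- rank p a counts the forward steps from p to a around the cycle.
  rank : Fin n → Fin n → ℕ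
  rank p a = (toℕ a + (n ∸ toℕ p)) % n

  rank< : ∀ p a → rank p a < n
  rank< p a = m%n<n (toℕ a + (n ∸ toℕ p)) n

  rank-spec : ∀ p a → toℕ a ≡ (toℕ p + rank p a) % n
  rank-spec p a = sym (begin
    (toℕ p + rank p a) % n                ≡⟨ +-congˡ-% (toℕ p) (m%n%n≡m%n (toℕ a + (n ∸ toℕ p)) n) ⟩
    (toℕ p + (toℕ a + (n ∸ toℕ p))) % n   ≡⟨ cong (_% n) (+-comm (toℕ p) (toℕ a + (n ∸ toℕ p))) ⟩
    (toℕ a + (n ∸ toℕ p) + toℕ p) % n     ≡⟨ cong (_% n) (+-assoc (toℕ a) (n ∸ toℕ p) (toℕ p)) ⟩
    (toℕ a + (n ∸ toℕ p + toℕ p)) % n     ≡⟨ cong (λ z → (toℕ a + z) % n) (m∸n+n≡m (<⇒≤ (toℕ<n p))) ⟩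
    (toℕ a + n) % n                       ≡⟨ [m+n]%n≡m%n (toℕ a) n ⟩
    toℕ a % n                             ≡⟨ m<n⇒m%n≡m (toℕ<n a) ⟩
    toℕ a                                 ∎)

  rank-injective : ∀ p {a b} → rank p a ≡ rank p b → a ≡ b
  rank-injective p {a} {b} eq =
    toℕ-injective (trans (rank-spec p a) (trans (cong (λ r → (toℕ p + r) % n) eq) (sym (rank-spec p b))))

  rank-self : ∀ p → rank p p ≡ 0
  rank-self p = trans (cong (_% n) (m+[n∸m]≡n (<⇒≤ (toℕ<n p)))) (n%n≡0 n)

  toℕ-next-rank : ∀ p a → toℕ (next a) ≡ (toℕ p + suc (rank p a)) % n
  toℕ-next-rank p a = trans (toℕ-next-% (rank-spec p a)) (cong (_% n) (sym (+-suc (toℕ p) (rank p a))))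

  rank-next : ∀ {p a} → next a ≢ p → rank p (next a) ≡ suc (rank p a)
  rank-next {p} {a} next≢p with m≤n⇒m<n∨m≡n (rank< p a)
  ... | inj₁ 1+r<n = +-cancelˡ-% (toℕ p) (rank< p (next a)) 1+r<n
                       (trans (sym (rank-spec p (next a))) (toℕ-next-rank p a))
  ... | inj₂ 1+r≡n = contradiction (toℕ-injective (begin
    toℕ (next a)                   ≡⟨ toℕ-next-rank p a ⟩
    (toℕ p + suc (rank p a)) % n   ≡⟨ cong (λ r → (toℕ p + r) % n) 1+r≡n ⟩
    (toℕ p + n) % n                ≡⟨ [m+n]%n≡m%n (toℕ p) n ⟩
    toℕ p % n                      ≡⟨ m<n⇒m%n≡m (toℕ<n p) ⟩
    toℕ p                          ∎)) next≢p

  rank-suc⇒next : ∀ {p a b} → rank p b ≡ suc (rank p a) → next a ≡ b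
  rank-suc⇒next {p} {a} {b} eq = toℕ-injective (begin
    toℕ (next a)                   ≡⟨ toℕ-next-rank p a ⟩
    (toℕ p + suc (rank p a)) % n   ≡⟨ cong (λ r → (toℕ p + r) % n) eq ⟨
    (toℕ p + rank p b) % n         ≡⟨ rank-spec p b ⟨
    toℕ b                          ∎)

  cyclic-induction : (P : Fin n → Set) (a : Fin n) → P a → (∀ b → P b → P (next b)) → ∀ b → P b
  cyclic-induction P a Pa step b = go (rank a b) b refl
    where
    go : ∀ t b → rank a b ≡ t → P b
    go zero    b r = subst P (rank-injective a (trans (rank-self a) (sym r))) Pa
    go (suc t) b r = subst P (next-prev b) (step (prev b) (go t (prev b) (suc-injective (trans (sym rank-b) r))))
      where
      prev-b↛a : next (prev b) ≢ a
      prev-b↛a eq = 0≢1+n (trans (sym (rank-self a)) (trans (cong (rank a) (trans (sym eq) (next-prev b))) r))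
      rank-b : rank a b ≡ suc (rank a (prev b))
      rank-b = trans (cong (rank a) (sym (next-prev b))) (rank-next prev-b↛a)

  cyclic-descent : (w : Fin n → Bool) → ¬ (∀ a → w a ≡ true) → ¬ (∀ a → w a ≡ false) →
    ∃ λ a → w a ≡ true × w (next a) ≡ false
  cyclic-descent w ¬all-true ¬all-false
    with any? (λ a → (w a Bool.≟ true) ×-dec (w (next a) Bool.≟ false))
  ... | yes descent = descent
  ... | no no-descent = contradiction all-true ¬all-true
    where
    some-true : ∃ λ a → w a ≡ true
    some-true with ¬∀⟶∃¬ n (λ a → w a ≡ false) (λ a → w a Bool.≟ false) ¬all-false
    ... | a , wa≢false = a , ¬-not wa≢false
    all-true : ∀ a → w a ≡ true
    all-true = cyclic-induction (λ a → w a ≡ true) (proj₁ some-true) (proj₂ some-true)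
      (λ b wb → ¬-not (λ wnb → no-descent (b , wb , wnb)))

finite-argmax : ∀ {L} (ρ : Fin (suc L) → ℕ) → ∃ λ top → ∀ i → ρ i ≤ ρ top
finite-argmax {L} ρ = argmax ρ Fin.zero (allFin (suc L)) ,
  λ i → All.lookup (f[xs]≤f[argmax] {f = ρ} Fin.zero (allFin (suc L))) (∈-allFin i)

-- A maximum of ρ has both cyclic neighbours one below it, so they coincide by injectivity.
unit-step-cycle-length≤2 : ∀ {L} (ρ : Fin L → ℕ) → Injective _≡_ _≡_ ρ →
  (∀ i → ρ (next i) ≡ suc (ρ i) ⊎ ρ i ≡ suc (ρ (next i))) → L ≤ 2
unit-step-cycle-length≤2 {zero} ρ _ _ = z≤n
unit-step-cycle-length≤2 {suc L} ρ ρ-inj step = around (finite-argmax ρ)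
  where
  around : (∃ λ top → ∀ i → ρ i ≤ ρ top) → suc L ≤ 2
  around (top , ≤top) = next²≡id⇒≤2 top (begin
    next (next top)   ≡⟨ cong next (ρ-inj (suc-injective (trans (sym top≡1+next) top≡1+prev))) ⟩
    next (prev top)   ≡⟨ next-prev top ⟩
    top               ∎)
    where
    not-above-top : ∀ i → ρ i ≢ suc (ρ top)
    not-above-top i eq = 1+n≰n (subst (_≤ ρ top) eq (≤top i))
    top≡1+next : ρ top ≡ suc (ρ (next top))
    top≡1+next = [ (λ up → contradiction up (not-above-top (next top))) , (λ down → down) ]′ (step top)
    top≡1+prev : ρ top ≡ suc (ρ (prev top))
    top≡1+prev = [ (λ up → trans (cong ρ (sym (next-prev top))) up)
                 , (λ down → contradiction (trans down (cong (suc ∘ ρ) (next-prev top))) (not-above-top (prev top))) ]′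
                 (step (prev top))

Adjacent : ∀ {n} → Fin n → Fin n → Set
Adjacent x y = next x ≡ y ⊎ next y ≡ x

adjacent? : ∀ {n} (x y : Fin n) → Dec (Adjacent x y)
adjacent? x y = (next x Fin.≟ y) ⊎-dec (next y Fin.≟ x)

Adjacent⇔CycAdj : ∀ {n} {x y : Fin n} → Adjacent x y ⇔ CycAdj n x y
Adjacent⇔CycAdj {n} {x} {y} = mk⇔ to from
  where
  to : Adjacent x y → CycAdj n x y
  to (inj₁ fwd) with subst (CycSucc n x) fwd (CycSucc-next x)
  ... | inj₁ y≡1+x = inj₁ y≡1+x
  ... | inj₂ (1+x≡n , y≡0) = inj₂ (inj₂ (inj₂ (y≡0 , 1+x≡n)))
  to (inj₂ bwd) with subst (CycSucc n y) bwd (CycSucc-next y)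
  ... | inj₁ x≡1+y = inj₂ (inj₁ x≡1+y)
  ... | inj₂ (1+y≡n , x≡0) = inj₂ (inj₂ (inj₁ (x≡0 , 1+y≡n)))
  from : CycAdj n x y → Adjacent x y
  from (inj₁ y≡1+x) = inj₁ (CycSucc⇒next (inj₁ y≡1+x))
  from (inj₂ (inj₁ x≡1+y)) = inj₂ (CycSucc⇒next (inj₁ x≡1+y))
  from (inj₂ (inj₂ (inj₁ (x≡0 , 1+y≡n)))) = inj₂ (CycSucc⇒next (inj₂ (1+y≡n , x≡0)))
  from (inj₂ (inj₂ (inj₂ (y≡0 , 1+x≡n)))) = inj₁ (CycSucc⇒next (inj₂ (1+x≡n , y≡0)))

cycle-avoiding-vertex-length≤2 : ∀ {n L} .{{_ : NonZero n}} (p : Fin n) (f : Fin L → Fin n) →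
  Injective _≡_ _≡_ f → (∀ i → f i ≢ p) → (∀ i → Adjacent (f i) (f (next i))) → L ≤ 2
cycle-avoiding-vertex-length≤2 p f f-inj avoids adjacent = unit-step-cycle-length≤2 (rank p ∘ f) (f-inj ∘ rank-injective p) step
  where
  step : ∀ i → rank p (f (next i)) ≡ suc (rank p (f i)) ⊎ rank p (f i) ≡ suc (rank p (f (next i)))
  step i with adjacent i
  ... | inj₁ fwd = inj₁ (trans (cong (rank p) (sym fwd)) (rank-next (λ eq → avoids (next i) (trans (sym fwd) eq))))
  ... | inj₂ bwd = inj₂ (trans (cong (rank p) (sym bwd)) (rank-next (λ eq → avoids i (trans (sym bwd) eq))))

dec-true⁻¹ : ∀ {A : Set} (a? : Dec A) → does a? ≡ true → A
dec-true⁻¹ (yes a) _ = a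

does≡true⇔ : ∀ {A : Set} (a? : Dec A) → does a? ≡ true ⇔ A
does≡true⇔ a? = mk⇔ (dec-true⁻¹ a?) (dec-true a?)

missing⊎surjective : ∀ {m n} (f : Fin m → Fin n) →
  (∃ λ p → ∀ i → f i ≢ p) ⊎ (∀ p → ∃ λ i → f i ≡ p)
missing⊎surjective {m} f with any? (λ p → all? (λ i → ¬? (f i Fin.≟ p)))
... | yes missing = inj₁ missing
... | no ¬missing = inj₂ preimage
  where
  preimage : ∀ p → ∃ λ i → f i ≡ p
  preimage p with ¬∀⟶∃¬ m _ (λ i → ¬? (f i Fin.≟ p)) (λ avoids → ¬missing (p , avoids))
  ... | i , ¬¬fi≡p = i , decidable-stable (f i Fin.≟ p) ¬¬fi≡p

surjective⇒≤ : ∀ {m n} {f : Fin m → Fin n} → (∀ p → ∃ λ i → f i ≡ p) → n ≤ m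
surjective⇒≤ {f = f} onto = injective⇒≤ {f = proj₁ ∘ onto}
  (λ {p} {p′} eq → trans (sym (proj₂ (onto p))) (trans (cong f eq) (proj₂ (onto p′))))

<⇒missing : ∀ {m n} → m < n → (f : Fin m → Fin n) → ∃ λ p → ∀ i → f i ≢ p
<⇒missing m<n f = [ (λ missing → missing) , (λ onto → contradiction (surjective⇒≤ onto) (<⇒≱ m<n)) ]′
                    (missing⊎surjective f)

path-constant : ∀ {A : Set} {n} (h : Fin (suc n) → A) →
  (∀ i → h (Fin.inject₁ i) ≡ h (Fin.suc i)) → ∀ i → h i ≡ h Fin.zero
path-constant h step Fin.zero = refl
path-constant {n = suc n} h step (Fin.suc i) =
  trans (sym (step i)) (path-constant (h ∘ Fin.inject₁) (step ∘ Fin.inject₁) i)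

cycleGraph : (n : ℕ) → 2 ≤ n → Graph n
cycleGraph n 2≤n = record
  { adj    = λ x y → does (adjacent? x y)
  ; sym    = λ x y → does-⇔ (mk⇔ swap swap) (adjacent? x y) (adjacent? y x)
  ; irrefl = λ x → dec-false (adjacent? x x) λ { (inj₁ eq) → no-loop x eq ; (inj₂ eq) → no-loop x eq }
  }
  where
  no-loop = next≢id {{>-nonZero (≤-trans (s≤s z≤n) 2≤n)}} 2≤n

cycleGraph-hole-length : ∀ {n L} .{{_ : NonZero n}} (2≤n : 2 ≤ n) → HasHoleOfLength (cycleGraph n 2≤n) L → L ≡ n
cycleGraph-hole-length {n} {L} 2≤n (f , 4≤L , f-inj , f-adj) =
  [ avoiding , ≤-antisym (injective⇒≤ f-inj) ∘ surjective⇒≤ ]′ (missing⊎surjective f)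
  where
  consecutive : ∀ i → Adjacent (f i) (f (next i))
  consecutive i = dec-true⁻¹ (adjacent? _ _)
    (Equivalence.from (f-adj i (next i)) (Equivalence.to Adjacent⇔CycAdj (inj₁ refl)))
  avoiding : (∃ λ p → ∀ i → f i ≢ p) → L ≡ n
  avoiding (p , avoids) = contradiction (cycle-avoiding-vertex-length≤2 p f f-inj avoids consecutive)
                                        (<⇒≱ (≤-trans (s≤s (s≤s (s≤s z≤n))) 4≤L))

cycleGraph-hole : ∀ {n} (2≤n : 2 ≤ n) → 4 ≤ n → HasHoleOfLength (cycleGraph n 2≤n) n
cycleGraph-hole 2≤n 4≤n =
  (λ x → x) , 4≤n , (λ eq → eq) , λ x y → Adjacent⇔CycAdj ⇔-∘ does≡true⇔ (adjacent? x y)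

copies : ∀ {n} (T : ℕ) → Graph n → Graph (T * n)
copies {n} T G = record
  { adj    = λ u v → does (copy u Fin.≟ copy v) ∧ adj G (position u) (position v)
  ; sym    = λ u v → cong₂ _∧_ (does-⇔ (mk⇔ sym sym) (copy u Fin.≟ copy v) (copy v Fin.≟ copy u))
                                (Graph.sym G (position u) (position v))
  ; irrefl = λ u → trans (cong (does (copy u Fin.≟ copy u) ∧_) (Graph.irrefl G (position u))) (∧-zeroʳ _)
  }
  where
  copy = Fin.quotient {T} n
  position = Fin.remainder {T} n

module _ {n : ℕ} (T : ℕ) (G : Graph n) where

  copies-adj : ∀ (c : Fin T) a c′ b →
    adj (copies T G) (Fin.combine c a) (Fin.combine c′ b) ≡ does (c Fin.≟ c′) ∧ adj G a b
  copies-adj c a c′ b = cong₂ (λ u v → does (proj₁ u Fin.≟ proj₁ v) ∧ adj G (proj₂ u) (proj₂ v))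
    (remQuot-combine c a) (remQuot-combine c′ b)

  copies-adj-same : ∀ (c : Fin T) a b → adj (copies T G) (Fin.combine c a) (Fin.combine c b) ≡ adj G a b
  copies-adj-same c a b = trans (copies-adj c a c b) (cong (_∧ adj G a b) (dec-true (c Fin.≟ c) refl))

  copies-neighbour : ∀ (c : Fin T) a v → adj (copies T G) (Fin.combine c a) v ≡ true →
    ∃ λ b → v ≡ Fin.combine c b × adj G a b ≡ true
  copies-neighbour c a v c-a~v =
    position v , trans (sym v≡) (cong (λ c′ → Fin.combine c′ _) (sym same-copy)) , ∧-conicalʳ _ _ adj′
    where
    copy = Fin.quotient {T} n
    position = Fin.remainder {T} n
    v≡ : Fin.combine (copy v) (position v) ≡ v
    v≡ = combine-remQuot {T} n v
    adj′ : does (c Fin.≟ copy v) ∧ adj G a (position v) ≡ true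
    adj′ = trans (sym (copies-adj c a _ _)) (trans (cong (adj (copies T G) (Fin.combine c a)) v≡) c-a~v)
    same-copy : c ≡ copy v
    same-copy = dec-true⁻¹ (c Fin.≟ _) (∧-conicalˡ _ _ adj′)

  hole-in-copies : ∀ {L} → HasHoleOfLength (copies T G) L → HasHoleOfLength G L
  hole-in-copies {zero} (_ , () , _)
  hole-in-copies {suc L} (f , 4≤L , f-inj , f-adj) =
    position ∘ f , 4≤L , position∘f-inj ,
    λ i j → subst (λ b → b ≡ true ⇔ CycAdj (suc L) i j) (within-copy i j) (f-adj i j)
    where
    copy = Fin.quotient {T} n
    position = Fin.remainder {T} n
    one-copy : ∀ i → copy (f i) ≡ copy (f Fin.zero)
    one-copy = path-constant (copy ∘ f) λ i → dec-true⁻¹ (copy (f _) Fin.≟ copy (f _))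
      (∧-conicalˡ _ _ (Equivalence.from (f-adj (Fin.inject₁ i) (Fin.suc i)) (inj₁ (cong suc (sym (toℕ-inject₁ i))))))
    within-copy : ∀ i j → adj (copies T G) (f i) (f j) ≡ adj G (position (f i)) (position (f j))
    within-copy i j = cong (_∧ adj G (position (f i)) (position (f j)))
      (dec-true (copy (f i) Fin.≟ copy (f j)) (trans (one-copy i) (sym (one-copy j))))
    position∘f-inj : Injective _≡_ _≡_ (position ∘ f)
    position∘f-inj {i} {j} eq = f-inj (begin
      f i                                       ≡⟨ combine-remQuot {T} n (f i) ⟨
      Fin.combine (copy (f i)) (position (f i)) ≡⟨ cong₂ Fin.combine (trans (one-copy i) (sym (one-copy j))) eq ⟩
      Fin.combine (copy (f j)) (position (f j)) ≡⟨ combine-remQuot {T} n (f j) ⟩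
      f j                                       ∎)

  copies∈Pk : ∀ {k} → Pk k n G → Pk k (T * n) (copies T G)
  copies∈Pk G∈Pk L k∣L hole = G∈Pk L k∣L (hole-in-copies hole)

cycleGraph∈Pk : ∀ {k n} .{{_ : NonZero n}} (2≤n : 2 ≤ n) → ¬ k ∣ n → Pk k n (cycleGraph n 2≤n)
cycleGraph∈Pk {k} 2≤n k∤n L k∣L hole = k∤n (subst (k ∣_) (cycleGraph-hole-length 2≤n hole) k∣L)

cycleGraph∉Pk : ∀ {k n} (2≤n : 2 ≤ n) → 4 ≤ n → k ∣ n → ¬ Pk k n (cycleGraph n 2≤n)
cycleGraph∉Pk 2≤n 4≤n k∣n n∈Pk = n∈Pk _ k∣n (cycleGraph-hole 2≤n 4≤n)

module Orientation {n : ℕ} (G : Graph n) (D : OGraph n) (D-orient : IsOrientation G D) where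

  arc⇒adj : ∀ {u v} → arc D u v ≡ true → adj G u v ≡ true
  arc⇒adj {u} {v} uv = trans (D-orient u v) (cong (_∨ arc D v u) uv)

  nonadjacent⇒no-arc : ∀ {u v} → adj G u v ≡ false → arc D u v ≡ false
  nonadjacent⇒no-arc {u} {v} ¬uv = ∨-conicalˡ _ _ (trans (sym (D-orient u v)) ¬uv)

module Pullback {n n′ : ℕ} (G : Graph n) (G′ : Graph n′) (D′ : OGraph n′) (D′-orient : IsOrientation G′ D′)
  (h : Fin n → Fin n′) (h-hom : ∀ {u v} → adj G u v ≡ true → adj G′ (h u) (h v) ≡ true) where

  pullback : OGraph n
  pullback = record
    { arc    = λ u v → adj G u v ∧ arc D′ (h u) (h v)
    ; irrefl = λ u → cong (_∧ arc D′ (h u) (h u)) (Graph.irrefl G u)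
    ; asym   = λ u v uv → trans (cong (adj G v u ∧_) (asym D′ _ _ (∧-conicalʳ _ _ uv))) (∧-zeroʳ _)
    }

  pullback-orientation : IsOrientation G pullback
  pullback-orientation u v rewrite Graph.sym G v u with adj G u v in u~v
  ... | false = refl
  ... | true  = sym (trans (sym (D′-orient (h u) (h v))) (h-hom u~v))

module _ {n : ℕ} (D : OGraph n) where

  directed-cycle : ∀ {L} (h : Fin L → Fin n) → 2 ≤ L → Injective _≡_ _≡_ h →
    (∀ i → arc D (h i) (h (next i)) ≡ true) → HasDirectedCycle D
  directed-cycle {L} h 2≤L h-inj step =
    L , h , 2≤L , h-inj , λ i j i→j → subst (λ j → arc D (h i) (h j) ≡ true) (CycSucc⇒next i→j) (step i)

  no-directed-2-cycle : ∀ {L} → L ≡ 2 → (f : Fin L → Fin n) → ¬ (∀ i → arc D (f i) (f (next i)) ≡ true)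
  no-directed-2-cycle refl f step = contradiction (trans (sym (step (Fin.suc Fin.zero))) (asym D _ _ (step Fin.zero))) λ ()

  IsSink : Fin n → Set
  IsSink v = ∀ w → arc D v w ≡ false

sink⇒acyclic : ∀ {n} .{{_ : NonZero n}} (2≤n : 2 ≤ n) (D : OGraph n) (σ : Fin n) →
  IsOrientation (cycleGraph n 2≤n) D → IsSink D σ → Acyclic D
sink⇒acyclic {n} 2≤n D σ D-orient σ-sink (L , f , 2≤L , f-inj , arcs) =
  no-directed-2-cycle D (≤-antisym (cycle-avoiding-vertex-length≤2 σ f f-inj avoids consecutive) 2≤L) f step
  where
  step : ∀ i → arc D (f i) (f (next i)) ≡ true
  step i = arcs i (next i) (CycSucc-next i)
  avoids : ∀ i → f i ≢ σ
  avoids i refl = contradiction (trans (sym (step i)) (σ-sink _)) λ ()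
  consecutive : ∀ i → Adjacent (f i) (f (next i))
  consecutive i = dec-true⁻¹ (adjacent? (f i) (f (next i))) (Orientation.arc⇒adj (cycleGraph n 2≤n) D D-orient (step i))

Unique⇒lookup-injective : ∀ {A : Set} {xs : List A} → Unique xs → ∀ {i j} → lookup xs i ≡ lookup xs j → i ≡ j
Unique⇒lookup-injective (x∉xs ∷ _) {Fin.zero} {Fin.zero} _ = refl
Unique⇒lookup-injective (x∉xs ∷ _) {Fin.zero} {Fin.suc j} eq = contradiction eq (All.lookup x∉xs (∈-lookup j))
Unique⇒lookup-injective (x∉xs ∷ _) {Fin.suc i} {Fin.zero} eq = contradiction (sym eq) (All.lookup x∉xs (∈-lookup i))
Unique⇒lookup-injective (_ ∷ xs-unique) {Fin.suc i} {Fin.suc j} eq = cong Fin.suc (Unique⇒lookup-injective xs-unique eq)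

larger-half : ∀ {a b c} → a + a ≤ b + c → a ≤ b ⊎ a ≤ c
larger-half {a} {b} {c} a+a≤b+c with a ≤? b
... | yes a≤b = inj₁ a≤b
... | no a≰b = inj₂ (≮⇒≥ λ c<a → <⇒≱ (+-mono-< (≰⇒> a≰b) c<a) a+a≤b+c)

module _ {A : Set} where

  MonochromaticSublist : ∀ {d} → (A → Vector Bool d) → ℕ → List A → Set
  MonochromaticSublist {d} κ R xs =
    Σ (List A) λ ys → Unique ys × ys ⊆ xs × R ≤ length ys ×
      Σ (Vector Bool d) λ v → ∀ {y} → y ∈ ys → ∀ k → κ y k ≡ v k

  colour-classes : (f : A → Bool) (xs : List A) →
    length (filter (λ y → f y Bool.≟ true) xs) + length (filter (λ y → f y Bool.≟ false) xs) ≡ length xs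
  colour-classes f List.[] = refl
  colour-classes f (x List.∷ xs) with f x
  ... | true  = cong suc (colour-classes f xs)
  ... | false = trans (+-suc _ _) (cong suc (colour-classes f xs))

  monochromatic-sublist : ∀ d (κ : A → Vector Bool d) R xs → Unique xs → R * 2 ^ d ≤ length xs →
    MonochromaticSublist κ R xs
  monochromatic-sublist zero κ R xs xs-unique R≤xs =
    xs , xs-unique , (λ y∈xs → y∈xs) , subst (_≤ length xs) (*-identityʳ R) R≤xs , (λ ()) , λ _ ()
  monochromatic-sublist (suc d) κ R xs xs-unique R≤xs =
    [ refine true , refine false ]′
      (larger-half (subst₂ _≤_ double (sym (colour-classes (λ y → κ y Fin.zero) xs)) R≤xs))
    where
    double : R * 2 ^ suc d ≡ R * 2 ^ d + R * 2 ^ d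
    double = trans (*-distribˡ-+ R (2 ^ d) (2 ^ d + 0)) (cong (λ z → R * 2 ^ d + R * z) (+-identityʳ (2 ^ d)))
    has-colour : ∀ b y → Dec (κ y Fin.zero ≡ b)
    has-colour b y = κ y Fin.zero Bool.≟ b
    refine : ∀ b → R * 2 ^ d ≤ length (filter (has-colour b) xs) → MonochromaticSublist κ R xs
    refine b R≤class = extend (monochromatic-sublist d (Vector.tail ∘ κ) R (filter (has-colour b) xs)
                                (Unique.filter⁺ (has-colour b) xs-unique) R≤class)
      where
      extend : MonochromaticSublist (Vector.tail ∘ κ) R (filter (has-colour b) xs) → MonochromaticSublist κ R xs
      extend (ys , ys-unique , ys⊆class , R≤ys , v , mono) =
        ys , ys-unique , proj₁ ∘ in-class , R≤ys , b Vector.∷ v , coloured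
        where
        in-class : ∀ {y} → y ∈ ys → y ∈ xs × κ y Fin.zero ≡ b
        in-class = ∈-filter⁻ (has-colour b) {xs = xs} ∘ ys⊆class
        coloured : ∀ {y} → y ∈ ys → ∀ k → κ y k ≡ (b Vector.∷ v) k
        coloured y∈ys Fin.zero = proj₂ (in-class y∈ys)
        coloured y∈ys (Fin.suc k) = mono y∈ys k

monochromatic-family : ∀ {T} d R (κ : Fin T → Vector Bool d) → R * 2 ^ d ≤ T →
  Σ (Fin R → Fin T) λ e → Injective _≡_ _≡_ e × ∀ c c′ k → κ (e c) k ≡ κ (e c′) k
monochromatic-family {T} d R κ R*2^d≤T = family (monochromatic-sublist d κ R (allFin T) (Unique.allFin⁺ T)
  (subst (R * 2 ^ d ≤_) (sym (length-tabulate {n = T} (λ c → c))) R*2^d≤T))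
  where
  family : MonochromaticSublist κ R (allFin T) →
    Σ (Fin R → Fin T) λ e → Injective _≡_ _≡_ e × ∀ c c′ k → κ (e c) k ≡ κ (e c′) k
  family (ys , ys-unique , _ , R≤ys , v , mono) =
    e , (λ eq → inject≤-injective R≤ys R≤ys _ _ (Unique⇒lookup-injective ys-unique eq)) ,
    λ c c′ k → trans (mono (∈-lookup _) k) (sym (mono (∈-lookup _) k))
    where
    e : Fin R → Fin T
    e c = lookup ys (Fin.inject≤ c R≤ys)

module _ {P : ℕ → Set} (P? : Decidable P) where

  run-start : ℕ → ℕ
  run-start zero = zero
  run-start (suc s) with P? s
  ... | yes _ = run-start s
  ... | no _  = suc s

  run-start-≤ : ∀ r → run-start r ≤ r
  run-start-≤ zero = z≤n
  run-start-≤ (suc s) with P? s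
  ... | yes _ = m≤n⇒m≤1+n (run-start-≤ s)
  ... | no _  = ≤-refl

  run-start-step : ∀ {s} → P s → run-start (suc s) ≡ run-start s
  run-start-step {s} Ps with P? s
  ... | yes _ = refl
  ... | no ¬Ps = contradiction Ps ¬Ps

  run-start-run : ∀ r {t} → run-start r ≤ t → t < r → P t
  run-start-run (suc s) {t} start≤t t<1+s with P? s
  ... | no _ = contradiction t<1+s (≤⇒≯ start≤t)
  ... | yes Ps with m≤n⇒m<n∨m≡n (≤-pred t<1+s)
  ...   | inj₁ t<s = run-start-run s start≤t t<s
  ...   | inj₂ refl = Ps

module Unrolling {q M T : ℕ} .{{_ : NonZero q}} .{{_ : NonZero M}} (2≤q : 2 ≤ q) (2≤M : 2 ≤ M) (q∣M : q ∣ M)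
  (D : OGraph (T * q)) (D-orient : IsOrientation (copies T (cycleGraph q 2≤q)) D) (c₀ : Fin T) where

  Cycles : Graph (T * q)
  Cycles = copies T (cycleGraph q 2≤q)

  open Orientation Cycles D D-orient

  reduce : Fin M → Fin q
  reduce x = toℕ x mod q

  toℕ-reduce : ∀ x → toℕ (reduce x) ≡ toℕ x % q
  toℕ-reduce x = toℕ-fromℕ< _

  reduce-next : ∀ x → reduce (next x) ≡ next (reduce x)
  reduce-next x = toℕ-injective (begin
    toℕ (reduce (next x))   ≡⟨ toℕ-reduce (next x) ⟩
    toℕ (next x) % q        ≡⟨ cong (_% q) (toℕ-next x) ⟩
    suc (toℕ x) % M % q     ≡⟨ m∣n⇒o%n%m≡o%m q M (suc (toℕ x)) q∣M ⟩
    suc (toℕ x) % q         ≡⟨ toℕ-next-% (toℕ-reduce x) ⟨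
    toℕ (next (reduce x))   ∎)

  reduce-adjacent : ∀ {x y} → Adjacent x y → Adjacent (reduce x) (reduce y)
  reduce-adjacent (inj₁ fwd) = inj₁ (trans (sym (reduce-next _)) (cong reduce fwd))
  reduce-adjacent (inj₂ bwd) = inj₂ (trans (sym (reduce-next _)) (cong reduce bwd))

  at : Fin q → Fin (T * q)
  at = Fin.combine c₀

  at-injective : Injective _≡_ _≡_ at
  at-injective {a} {b} = combine-injectiveʳ c₀ a c₀ b

  at-adjacent : ∀ {a b} → Adjacent a b → adj Cycles (at a) (at b) ≡ true
  at-adjacent {a} {b} a~b = trans (copies-adj-same T (cycleGraph q 2≤q) c₀ a b) (dec-true (adjacent? a b) a~b)

  at∘reduce-hom : ∀ {x y} → adj (cycleGraph M 2≤M) x y ≡ true → adj Cycles (at (reduce x)) (at (reduce y)) ≡ true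
  at∘reduce-hom {x} {y} x~y = at-adjacent (reduce-adjacent (dec-true⁻¹ (adjacent? x y) x~y))

  open Pullback (cycleGraph M 2≤M) Cycles D D-orient (at ∘ reduce) at∘reduce-hom public
    renaming (pullback to unrolled; pullback-orientation to unrolled-orientation)

  forward : Fin q → Bool
  forward a = arc D (at a) (at (next a))

  backward-arc : ∀ a → forward a ≡ false → arc D (at (next a)) (at a) ≡ true
  backward-arc a a↛ =
    sym (trans (sym (at-adjacent (inj₁ refl))) (trans (D-orient _ _) (cong (_∨ arc D (at (next a)) (at a)) a↛)))

  ¬all-forward : Acyclic D → ¬ (∀ a → forward a ≡ true)
  ¬all-forward acyclic all = acyclic (directed-cycle D at 2≤q at-injective all)

  ¬all-backward : Acyclic D → ¬ (∀ a → forward a ≡ false)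
  ¬all-backward acyclic all = acyclic (directed-cycle D (at ∘ Fin.opposite) 2≤q (opposite-injective ∘ at-injective) step)
    where
    opposite-injective : Injective _≡_ _≡_ (Fin.opposite {q})
    opposite-injective {a} {b} eq = trans (sym (opposite-involutive a)) (trans (cong Fin.opposite eq) (opposite-involutive b))
    step : ∀ i → arc D (at (Fin.opposite i)) (at (Fin.opposite (next i))) ≡ true
    step i = subst (λ z → arc D (at z) (at (Fin.opposite (next i))) ≡ true) (next-opposite-next i)
                   (backward-arc _ (all (Fin.opposite (next i))))

  copy-has-sink : Acyclic D → ∃ λ s → IsSink D (at s)
  copy-has-sink acyclic = sink-after (cyclic-descent forward (¬all-forward acyclic) (¬all-backward acyclic))
    where
    sink-after : (∃ λ a → forward a ≡ true × forward (next a) ≡ false) → ∃ λ s → IsSink D (at s)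
    sink-after (a , a→ , next-a↛) = next a , λ v → ¬-not (no-arc v)
      where
      no-arc : ∀ v → arc D (at (next a)) v ≢ true
      no-arc v s→v with copies-neighbour T (cycleGraph q 2≤q) c₀ (next a) v (arc⇒adj s→v)
      ... | b , refl , s~b with dec-true⁻¹ (adjacent? (next a) b) s~b
      ...   | inj₁ refl = contradiction (trans (sym s→v) next-a↛) λ ()
      ...   | inj₂ next-b≡next-a with next-injective next-b≡next-a
      ...     | refl = contradiction (trans (sym s→v) (asym D _ _ a→)) λ ()

  unrolled-sink : ∀ {s} → IsSink D (at s) → IsSink unrolled (Fin.inject≤ s (∣⇒≤ q∣M))
  unrolled-sink {s} s-sink w =
    trans (cong (λ z → σ~w ∧ arc D (at z) (at (reduce w))) reduce-σ)
          (trans (cong (σ~w ∧_) (s-sink _)) (∧-zeroʳ σ~w))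
    where
    σ : Fin M
    σ = Fin.inject≤ s (∣⇒≤ q∣M)
    reduce-σ : reduce σ ≡ s
    reduce-σ = toℕ-injective (trans (toℕ-reduce σ) (trans (cong (_% q) (toℕ-inject≤ s _)) (m<n⇒m%n≡m (toℕ<n s))))
    σ~w : Bool
    σ~w = adj (cycleGraph M 2≤M) σ w

  unrolled-acyclic : Acyclic D → Acyclic unrolled
  unrolled-acyclic acyclic =
    let s , s-sink = copy-has-sink acyclic in sink⇒acyclic 2≤M unrolled _ unrolled-orientation (unrolled-sink s-sink)

  module Embedding (e : Fin M → Fin T) (e-inj : Injective _≡_ _≡_ e)
    (same-pattern : ∀ c a b → arc D (Fin.combine (e c) a) (Fin.combine (e c) b) ≡ arc D (at a) (at b)) where

    module Run {m} (φ : Fin m → Fin M) (φ-inj : Injective _≡_ _≡_ φ) (m<q : m < q) where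

      p : Fin M
      p = proj₁ (<⇒missing (<-≤-trans m<q (∣⇒≤ q∣M)) φ)

      φ≢p : ∀ i → φ i ≢ p
      φ≢p = proj₂ (<⇒missing (<-≤-trans m<q (∣⇒≤ q∣M)) φ)

      rk : Fin m → ℕ
      rk i = rank p (φ i)

      hit? : Decidable (λ s → ∃ λ i → rk i ≡ s)
      hit? s = any? (λ i → rk i ≟ s)

      start : Fin m → ℕ
      start i = run-start hit? (rk i)

      SameRun : Fin m → Fin m → Set
      SameRun i j = start i ≡ start j

      start<M : ∀ i → start i < M
      start<M i = ≤-<-trans (run-start-≤ hit? (rk i)) (rank< p (φ i))

      -- Each maximal run of consecutive ranks gets a copy of its own, indexed by where the run starts.
      copy : Fin m → Fin T
      copy i = e (fromℕ< (start<M i))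

      ψ : Fin m → Fin (T * q)
      ψ i = Fin.combine (copy i) (reduce (φ i))

      same-copy⇒SameRun : ∀ {i j} → copy i ≡ copy j → SameRun i j
      same-copy⇒SameRun {i} {j} eq =
        trans (sym (toℕ-fromℕ< (start<M i))) (trans (cong toℕ (e-inj eq)) (toℕ-fromℕ< (start<M j)))

      SameRun⇒same-copy : ∀ {i j} → SameRun i j → copy i ≡ copy j
      SameRun⇒same-copy {i} {j} run = cong e (fromℕ<-cong _ _ run (start<M i) (start<M j))

      next⇒SameRun : ∀ {i j} → next (φ i) ≡ φ j → SameRun i j
      next⇒SameRun {i} {j} next-φi≡φj = sym (trans (cong (run-start hit?) rk-j≡1+rk-i) (run-start-step hit? (i , refl)))
        where
        rk-j≡1+rk-i : rk j ≡ suc (rk i)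
        rk-j≡1+rk-i =
          trans (cong (rank p) (sym next-φi≡φj)) (rank-next (λ eq → φ≢p j (trans (sym next-φi≡φj) eq)))

      adjacent⇒SameRun : ∀ {i j} → Adjacent (φ i) (φ j) → SameRun i j
      adjacent⇒SameRun (inj₁ fwd) = next⇒SameRun fwd
      adjacent⇒SameRun (inj₂ bwd) = sym (next⇒SameRun bwd)

      run-short : ∀ {i j d} → SameRun i j → rk j ≡ rk i + d → d < m
      run-short {i} {j} {d} run rk-j≡ = injective⇒≤ {f = witness} witness-inj
        where
        hit : ∀ t → t ≤ d → ∃ λ k → rk k ≡ rk i + t
        hit t t≤d with m≤n⇒m<n∨m≡n t≤d
        ... | inj₂ refl = j , rk-j≡
        ... | inj₁ t<d = run-start-run hit? (rk j)
          (≤-trans (≤-reflexive (sym run)) (≤-trans (run-start-≤ hit? (rk i)) (m≤m+n (rk i) t)))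
          (subst (rk i + t <_) (sym rk-j≡) (+-monoʳ-< (rk i) t<d))
        witness : Fin (suc d) → Fin m
        witness t = proj₁ (hit (toℕ t) (≤-pred (toℕ<n t)))
        witness-inj : Injective _≡_ _≡_ witness
        witness-inj {t} {t′} eq = toℕ-injective (+-cancelˡ-≡ (rk i) _ _
          (trans (sym (proj₂ (hit (toℕ t) _))) (trans (cong rk eq) (proj₂ (hit (toℕ t′) _)))))

      toℕ-reduce-φ : ∀ i → toℕ (reduce (φ i)) ≡ (toℕ p + rk i) % q
      toℕ-reduce-φ i = begin
        toℕ (reduce (φ i))      ≡⟨ toℕ-reduce (φ i) ⟩
        toℕ (φ i) % q           ≡⟨ cong (_% q) (rank-spec p (φ i)) ⟩
        (toℕ p + rk i) % M % q  ≡⟨ m∣n⇒o%n%m≡o%m q M _ q∣M ⟩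
        (toℕ p + rk i) % q      ∎

      module Ordered {i j} (run : SameRun i j) (i≤j : rk i ≤ rk j) where

        d : ℕ
        d = rk j ∸ rk i

        rk-j≡ : rk j ≡ rk i + d
        rk-j≡ = sym (m+[n∸m]≡n i≤j)

        1+d<q : suc d < q
        1+d<q = ≤-<-trans (run-short run rk-j≡) m<q

        u : ℕ
        u = toℕ p + rk i

        position-i : toℕ (reduce (φ i)) ≡ (u + 0) % q
        position-i = trans (toℕ-reduce-φ i) (cong (_% q) (sym (+-identityʳ u)))

        position-j : toℕ (reduce (φ j)) ≡ (u + d) % q
        position-j =
          trans (toℕ-reduce-φ j) (cong (_% q) (trans (cong (toℕ p +_) rk-j≡) (sym (+-assoc (toℕ p) (rk i) d))))

        reduce-injective : reduce (φ i) ≡ reduce (φ j) → i ≡ j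
        reduce-injective eq =
          φ-inj (rank-injective p (sym (trans rk-j≡ (trans (cong (rk i +_) (sym 0≡d)) (+-identityʳ (rk i))))))
          where
          0≡d : 0 ≡ d
          0≡d = +-cancelˡ-% u (>-nonZero⁻¹ q) (<-trans (n<1+n d) 1+d<q)
                  (trans (sym position-i) (trans (cong toℕ eq) position-j))

        adjacent : Adjacent (reduce (φ i)) (reduce (φ j)) → Adjacent (φ i) (φ j)
        adjacent (inj₁ fwd) =
          inj₁ (rank-suc⇒next {p = p} (trans rk-j≡ (trans (cong (rk i +_) (sym 1≡d)) (+-comm (rk i) 1))))
          where
          1≡d : 1 ≡ d
          1≡d = +-cancelˡ-% u 2≤q (<-trans (n<1+n d) 1+d<q) (begin
            (u + 1) % q              ≡⟨ cong (_% q) (+-suc u 0) ⟩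
            suc (u + 0) % q          ≡⟨ toℕ-next-% position-i ⟨
            toℕ (next (reduce (φ i))) ≡⟨ cong toℕ fwd ⟩
            toℕ (reduce (φ j))        ≡⟨ position-j ⟩
            (u + d) % q              ∎)
        adjacent (inj₂ bwd) = contradiction (+-cancelˡ-% u 1+d<q (>-nonZero⁻¹ q) (begin
            (u + suc d) % q           ≡⟨ cong (_% q) (+-suc u d) ⟩
            suc (u + d) % q           ≡⟨ toℕ-next-% position-j ⟨
            toℕ (next (reduce (φ j))) ≡⟨ cong toℕ bwd ⟩
            toℕ (reduce (φ i))        ≡⟨ position-i ⟩
            (u + 0) % q               ∎)) λ ()

      run-reduce-injective : ∀ {i j} → SameRun i j → reduce (φ i) ≡ reduce (φ j) → i ≡ j
      run-reduce-injective {i} {j} run eq with ≤-total (rk i) (rk j)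
      ... | inj₁ i≤j = Ordered.reduce-injective run i≤j eq
      ... | inj₂ j≤i = sym (Ordered.reduce-injective (sym run) j≤i (sym eq))

      run-adjacent : ∀ {i j} → SameRun i j → Adjacent (reduce (φ i)) (reduce (φ j)) → Adjacent (φ i) (φ j)
      run-adjacent {i} {j} run a~b with ≤-total (rk i) (rk j)
      ... | inj₁ i≤j = Ordered.adjacent run i≤j a~b
      ... | inj₂ j≤i = swap (Ordered.adjacent (sym run) j≤i (swap a~b))

      ψ-injective : Injective _≡_ _≡_ ψ
      ψ-injective {i} {j} eq = run-reduce-injective
        (same-copy⇒SameRun (combine-injectiveˡ (copy i) (reduce (φ i)) (copy j) (reduce (φ j)) eq))
        (combine-injectiveʳ (copy i) (reduce (φ i)) (copy j) (reduce (φ j)) eq)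

      ψ-nonadjacent : ∀ {i j} → ¬ Adjacent (φ i) (φ j) → adj Cycles (ψ i) (ψ j) ≡ false
      ψ-nonadjacent {i} {j} ¬φi~φj = trans (copies-adj T (cycleGraph q 2≤q) (copy i) _ (copy j) _) different-copies-or-apart
        where
        different-copies-or-apart :
          does (copy i Fin.≟ copy j) ∧ adj (cycleGraph q 2≤q) (reduce (φ i)) (reduce (φ j)) ≡ false
        different-copies-or-apart with copy i Fin.≟ copy j
        ... | yes same = dec-false (adjacent? _ _) (¬φi~φj ∘ run-adjacent (same-copy⇒SameRun same))
        ... | no _ = refl

      ψ-arcs : ∀ i j → arc unrolled (φ i) (φ j) ≡ arc D (ψ i) (ψ j)
      ψ-arcs i j with adjacent? (φ i) (φ j)
      ... | yes φi~φj = begin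
        arc unrolled (φ i) (φ j)
          ≡⟨ cong (_∧ arc D (at (reduce (φ i))) (at (reduce (φ j)))) (dec-true (adjacent? (φ i) (φ j)) φi~φj) ⟩
        arc D (at (reduce (φ i))) (at (reduce (φ j)))
          ≡⟨ same-pattern _ _ _ ⟨
        arc D (ψ i) (Fin.combine (copy i) (reduce (φ j)))
          ≡⟨ cong (λ c → arc D (ψ i) (Fin.combine c _)) (SameRun⇒same-copy (adjacent⇒SameRun φi~φj)) ⟩
        arc D (ψ i) (ψ j)
          ∎
      ... | no ¬φi~φj = trans (cong (_∧ arc D (at (reduce (φ i))) (at (reduce (φ j))))
                                    (dec-false (adjacent? (φ i) (φ j)) ¬φi~φj))
                              (sym (nonadjacent⇒no-arc (ψ-nonadjacent ¬φi~φj)))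

    embedding : ∀ {m} {H : OGraph m} → m < q → EmbedsInduced H unrolled → EmbedsInduced H D
    embedding m<q (φ , φ-inj , φ-arcs) = ψ , ψ-injective , λ i j → trans (φ-arcs i j) (ψ-arcs i j)
      where open Run φ φ-inj m<q

    unrolled-free : ∀ {F} → (∀ {H} → H ∈ F → proj₁ H < q) → Free F D → Free F unrolled
    unrolled-free small D-free {H} H∈F H↪unrolled = D-free H∈F (embedding {H = proj₂ H} (small H∈F) H↪unrolled)


max-order : List AnyOGraph → ℕ
max-order F = max 0 (List.map proj₁ F)

order≤max-order : ∀ {F H} → H ∈ F → proj₁ H ≤ max-order F
order≤max-order {F} H∈F = All.lookup (xs≤max 0 (List.map proj₁ F)) (∈-map⁺ proj₁ H∈F)

module Counterexample (k : ℕ) (2≤k : 2 ≤ k) (F : List AnyOGraph) where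

  instance
    k-nonZero : NonZero k
    k-nonZero = >-nonZero (≤-trans (s≤s z≤n) 2≤k)

  q : ℕ
  q = suc (k * suc (max-order F))

  M : ℕ
  M = k * q

  T : ℕ
  T = M * 2 ^ (q * q)

  3≤q : 3 ≤ q
  3≤q = s≤s (*-mono-≤ 2≤k (s≤s z≤n))

  2≤q : 2 ≤ q
  2≤q = ≤-trans (n≤1+n 2) 3≤q

  4≤M : 4 ≤ M
  4≤M = ≤-trans (s≤s (s≤s (s≤s (s≤s z≤n)))) (*-mono-≤ 2≤k 3≤q)

  2≤M : 2 ≤ M
  2≤M = ≤-trans (s≤s (s≤s z≤n)) 4≤M

  instance
    M-nonZero : NonZero M
    M-nonZero = >-nonZero (≤-trans (s≤s z≤n) 2≤M)

  k∤q : ¬ k ∣ q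
  k∤q k∣q = contradiction (∣1⇒≡1 (∣m+n∣m⇒∣n (subst (k ∣_) (+-comm 1 _) k∣q) (m∣m*n (suc (max-order F)))))
                          (λ k≡1 → <⇒≢ 2≤k (sym k≡1))

  small : ∀ {H} → H ∈ F → proj₁ H < q
  small H∈F = s≤s (≤-trans (order≤max-order H∈F) (≤-trans (n≤1+n _) (m≤n*m (suc (max-order F)) k)))

  Cycles : Graph (T * q)
  Cycles = copies T (cycleGraph q 2≤q)

  Cycles∈Pk : Pk k (T * q) Cycles
  Cycles∈Pk = copies∈Pk T (cycleGraph q 2≤q) (cycleGraph∈Pk 2≤q k∤q)

  CycleM∉Pk : ¬ Pk k M (cycleGraph M 2≤M)
  CycleM∉Pk = cycleGraph∉Pk 2≤M 4≤M (m∣m*n q)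

  unroll : (D : OGraph (T * q)) → IsOrientation Cycles D →
    Σ (OGraph M) λ D′ →
      IsOrientation (cycleGraph M 2≤M) D′ × (Free F D → Free F D′) × (Acyclic D → Acyclic D′)
  unroll D D-orient = unrolled , unrolled-orientation , unrolled-free small , unrolled-acyclic
    where
    colour : Fin T → Vector Bool (q * q)
    colour c ab = arc D (Fin.combine c (proj₁ (Fin.remQuot {q} q ab))) (Fin.combine c (proj₂ (Fin.remQuot {q} q ab)))
    colour-combine : ∀ c a b → colour c (Fin.combine a b) ≡ arc D (Fin.combine c a) (Fin.combine c b)
    colour-combine c a b = cong (λ ab → arc D (Fin.combine c (proj₁ ab)) (Fin.combine c (proj₂ ab))) (remQuot-combine a b)
    family : Σ (Fin M → Fin T) λ e → Injective _≡_ _≡_ e × ∀ c c′ ab → colour (e c) ab ≡ colour (e c′) ab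
    family = monochromatic-family (q * q) M colour ≤-refl
    e : Fin M → Fin T
    e = proj₁ family
    c₁ : Fin M
    c₁ = fromℕ< (>-nonZero⁻¹ M)
    same-pattern : ∀ c a b →
      arc D (Fin.combine (e c) a) (Fin.combine (e c) b) ≡ arc D (Fin.combine (e c₁) a) (Fin.combine (e c₁) b)
    same-pattern c a b = begin
      arc D (Fin.combine (e c) a) (Fin.combine (e c) b)     ≡⟨ colour-combine (e c) a b ⟨
      colour (e c) (Fin.combine a b)                        ≡⟨ proj₂ (proj₂ family) c c₁ (Fin.combine a b) ⟩
      colour (e c₁) (Fin.combine a b)                       ≡⟨ colour-combine (e c₁) a b ⟩
      arc D (Fin.combine (e c₁) a) (Fin.combine (e c₁) b)   ∎
    open Unrolling 2≤q 2≤M (n∣m*n k) D D-orient (e c₁)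
      using (unrolled; unrolled-orientation; unrolled-acyclic; module Embedding)
    open Embedding e (proj₁ (proj₂ family)) same-pattern using (unrolled-free)

proposition14 : (k : ℕ) → 2 ≤ k →
    ¬ ExpressibleByForbiddenOrientations (Pk k) ×
    ¬ ExpressibleByForbiddenAcyclicOrientations (Pk k)
proposition14 k 2≤k = not-by-orientations , not-by-acyclic-orientations
  where
  not-by-orientations : ¬ ExpressibleByForbiddenOrientations (Pk k)
  not-by-orientations (F , expresses) =
    let open Counterexample k 2≤k F
        D , D-orient , D-free = Equivalence.to (expresses (T * q) Cycles) Cycles∈Pk
        D′ , D′-orient , keeps-free , _ = unroll D D-orient
    in CycleM∉Pk (Equivalence.from (expresses M (cycleGraph M 2≤M)) (D′ , D′-orient , keeps-free D-free))

  not-by-acyclic-orientations : ¬ ExpressibleByForbiddenAcyclicOrientations (Pk k)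
  not-by-acyclic-orientations (F , expresses) =
    let open Counterexample k 2≤k F
        D , D-orient , D-acyclic , D-free = Equivalence.to (expresses (T * q) Cycles) Cycles∈Pk
        D′ , D′-orient , keeps-free , keeps-acyclic = unroll D D-orient
    in CycleM∉Pk (Equivalence.from (expresses M (cycleGraph M 2≤M))
                   (D′ , D′-orient , keeps-acyclic D-acyclic , keeps-free D-free))
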